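{- Let $(W,R)$ be a quasi-ordered frame and $n\ge1$. 1. The topological space $W_R$ is hereditarily $(n+1)$-irresolvable iff $(W,R)$ has circumference at most $n$ and has no strictly ascending chains. 2. If $W$ is finite, then $W_R$ is hereditarily $(n+1)$-irresolvable iff $(W,R)$ has circumference at most $n$.
   Context: A quasi-order is a reflexive transitive relation. $W_R$ is $W$ with the Alexandroff topology whose open sets are the $R$-up-sets (if $x\in O$ and $xRy$ then $y\in O$). For $k\ge2$, a space is $k$-resolvable if it has $k$ pairwise disjoint dense subsets, $k$-irresolvable otherwise, and hereditarily $k$-irresolvable if every non-empty subspace is $k$-irresolvable. The circumference of a frame is the supremum of lengths $n$ of cycles (sequences of $n$ distinct points $x_0,\dots,x_{n-1}$ with $x_0R\cdots Rx_{n-1}Rx_0$), and 0 if none. A strictly ascending chain is a sequence $(x_m)_{m<\omega}$ with $x_mRx_{m+1}$ and not $x_{m+1}Rx_m$ for all $m$. -}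

module Defs where

open import Level using (0ℓ)
open import Data.Nat using (ℕ; zero; suc; _≤_)
open import Data.Fin using (Fin; inject₁; fromℕ) renaming (zero to fzero; suc to fsuc)
open import Data.Product using (Σ; _×_; ∃; ∃-syntax)
open import Data.Empty using (⊥)
open import Relation.Nullary using (¬_)
open import Relation.Binary.PropositionalEquality using (_≡_; _≢_)
open import Function.Definitions using (Injective)

Subset : Set → Set₁
Subset W = W → Set

-- Open sets of the Alexandroff space W_R: the R-up-sets.
IsOpen : {W : Set} → (W → W → Set) → Subset W → Set
IsOpen R O = ∀ {x y} → O x → R x y → O y

-- D is a dense subset of the subspace S of W_R: D ⊆ S and every non-empty
-- open set of the subspace S (i.e. O ∩ S with O open in W_R) meets D.
DenseIn : {W : Set} → (W → W → Set) → Subset W → Subset W → Set₁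
DenseIn {W} R S D =
  (∀ x → D x → S x) ×
  ((O : Subset W) → IsOpen R O → (∃[ x ] (S x × O x)) → ∃[ y ] (D y × O y))

Resolvable : {W : Set} → (W → W → Set) → ℕ → Subset W → Set₁
Resolvable {W} R k S =
  Σ (Fin k → Subset W) λ D →
    (∀ i → DenseIn R S (D i)) ×
    (∀ i j → i ≢ j → ∀ x → D i x → D j x → ⊥)

Irresolvable : {W : Set} → (W → W → Set) → ℕ → Subset W → Set₁
Irresolvable R k S = ¬ Resolvable R k S

HereditarilyIrresolvable : {W : Set} → (W → W → Set) → ℕ → Set₁
HereditarilyIrresolvable {W} R k =
  (S : Subset W) → (∃[ x ] S x) → Irresolvable R k S

-- A cycle of length suc m: distinct points x₀ … x_m with x₀ R x₁ R … R x_m R x₀.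
-- (There are no cycles of length 0.)
Cycle : {W : Set} → (W → W → Set) → ℕ → Set
Cycle {W} R m =
  Σ (Fin (suc m) → W) λ x →
    Injective _≡_ _≡_ x ×
    ((i : Fin m) → R (x (inject₁ i)) (x (fsuc i))) ×
    R (x (fromℕ m)) (x fzero)

CircumferenceAtMost : {W : Set} → (W → W → Set) → ℕ → Set
CircumferenceAtMost R n = ∀ m → Cycle R m → suc m ≤ n

StrictlyAscendingChain : {W : Set} → (W → W → Set) → Set
StrictlyAscendingChain {W} R =
  Σ (ℕ → W) λ x → ∀ m → R (x m) (x (suc m)) × ¬ R (x (suc m)) (x m)

-- In an Alexandroff space a set is dense in a subspace S iff it meets the R-cone of
-- every point of S. An (n+1)-cycle, or a strictly ascending chain coloured by
-- residues mod n+1, is therefore (n+1)-resolvable. Conversely, in an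
-- (n+1)-resolvable S every point has a strict successor in S: otherwise one point
-- above it from each dense set gives n+1 distinct mutually related points, i.e. a
-- cycle that is too long. Iterating the successor yields a strictly ascending
-- chain, which a finite frame cannot contain.
module Submission where

open import Defs
open import Level using (0ℓ)
open import Axiom.ExcludedMiddle using (ExcludedMiddle)
open import Data.Nat using (ℕ; suc; _≤_)
open import Data.Fin using (Fin)
open import Data.Product using (_×_)
open import Relation.Nullary using (¬_)
open import Relation.Binary.Definitions using (Reflexive; Transitive)
open import Function.Bundles using (_⇔_; _↔_)

open import Axiom.DoubleNegationElimination using (DoubleNegationElimination; em⇒dne)
open import Data.Nat using (zero; _+_; _*_; _<_; NonZero)
open import Data.Nat.Properties using (<-irrefl; <-cmp; ≤-trans; ≰⇒>; m≤m*n; m≤n+m; m∸n+n≡m; _≤?_)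
open import Data.Nat.DivMod using (_mod_; [m+kn]%n≡m%n; m<n⇒m%n≡m)
open import Data.Fin using (toℕ; inject₁; inject≤; fromℕ; _≟_) renaming (zero to fzero; suc to fsuc)
open import Data.Fin.Properties using (toℕ-injective; toℕ-fromℕ<; toℕ<n; inject≤-injective; ℕ→Fin-notInjective)
open import Data.Product using (Σ; ∃-syntax; _,_; proj₁; proj₂)
open import Data.Empty using (⊥; ⊥-elim)
open import Relation.Nullary using (yes; no)
open import Relation.Binary.Definitions using (tri<; tri≈; tri>)
open import Relation.Binary.PropositionalEquality using (_≡_; _≢_; refl; sym; trans; subst)
open import Function.Base using (_∘_)
open import Function.Bundles using (mk⇔; Injection)
open import Function.Definitions using (Injective)
open import Function.Properties.Inverse using (↔⇒↣)

Range : {A W : Set} → (A → W) → Subset W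
Range x y = ∃[ a ] (y ≡ x a)

IsClique : {A W : Set} → (W → W → Set) → (A → W) → Set
IsClique R x = ∀ a b → R (x a) (x b)

IsStrictlyAscending : {W : Set} → (W → W → Set) → (ℕ → W) → Set
IsStrictlyAscending R x = ∀ m → R (x m) (x (suc m)) × ¬ R (x (suc m)) (x m)

StrictSuccessorIn : {W : Set} → (W → W → Set) → Subset W → W → Set
StrictSuccessorIn R S x = ∃[ y ] (S y × R x y × ¬ R y x)

colouring⇒resolvable : {A W : Set} {R : W → W → Set} {k : ℕ} (x : A → W) → Injective _≡_ _≡_ x →
                       (colour : A → Fin k) → (∀ a i → ∃[ b ] (colour b ≡ i × R (x a) (x b))) →
                       Resolvable R k (Range x)
colouring⇒resolvable {A} {W} {R} {k} x x-injective colour cofinal = D , dense , disjoint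
  where
  D : Fin k → Subset W
  D i y = ∃[ a ] (y ≡ x a × colour a ≡ i)

  dense : ∀ i → DenseIn R (Range x) (D i)
  dense i = (λ { y (a , y≡xa , _) → a , y≡xa })
          , λ { O O-open (_ , (a , refl) , O-xa) →
                  let (b , colour-b , xa≤xb) = cofinal a i
                  in x b , (b , refl , colour-b) , O-open O-xa xa≤xb }

  disjoint : ∀ i j → i ≢ j → ∀ y → D i y → D j y → ⊥
  disjoint i j i≢j _ (a , refl , colour-a) (b , xa≡xb , colour-b) with x-injective xa≡xb
  ... | refl = i≢j (trans (sym colour-a) colour-b)

clique⇒resolvable : {W : Set} {R : W → W → Set} {k : ℕ} (x : Fin k → W) → Injective _≡_ _≡_ x →
                    IsClique R x → Resolvable R k (Range x)
clique⇒resolvable x x-injective clique =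
  colouring⇒resolvable x x-injective (λ i → i) (λ a i → i , refl , clique a i)

strictSuccessors⇒chain : {W : Set} {R : W → W → Set} {S : Subset W} →
                         (∀ {x} → S x → StrictSuccessorIn R S x) → ∃[ x ] S x →
                         StrictlyAscendingChain R
strictSuccessors⇒chain {W} {R} {S} successor (x₀ , x₀∈S) = proj₁ ∘ walk , ascending
  where
  walk : ℕ → Σ W S
  walk zero    = x₀ , x₀∈S
  walk (suc m) = let (y , y∈S , _) = successor (proj₂ (walk m)) in y , y∈S

  ascending : IsStrictlyAscending R (proj₁ ∘ walk)
  ascending m = proj₂ (proj₂ (successor (proj₂ (walk m))))

module _ {W : Set} {R : W → W → Set} (reflexive : Reflexive R) (transitive : Transitive R) where

  ascending⇒monotone : (x : ℕ → W) → (∀ m → R (x m) (x (suc m))) →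
                       ∀ {a b} → a ≤ b → R (x a) (x b)
  ascending⇒monotone x step {a} a≤b = subst (λ b → R (x a) (x b)) (m∸n+n≡m a≤b) (reach _)
    where
    reach : ∀ d → R (x a) (x (d + a))
    reach zero    = reflexive
    reach (suc d) = transitive (reach d) (step (d + a))

  strictlyAscending⇒distinct : (x : ℕ → W) → IsStrictlyAscending R x →
                               ∀ {a b} → a < b → x a ≢ x b
  strictlyAscending⇒distinct x ascending {a} a<b xa≡xb = proj₂ (ascending a)
    (subst (R (x (suc a))) (sym xa≡xb) (ascending⇒monotone x (proj₁ ∘ ascending) a<b))

  strictlyAscending-injective : (x : ℕ → W) → IsStrictlyAscending R x → Injective _≡_ _≡_ x
  strictlyAscending-injective x ascending {a} {b} xa≡xb with <-cmp a b
  ... | tri< a<b _ _ = ⊥-elim (strictlyAscending⇒distinct x ascending a<b xa≡xb)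
  ... | tri≈ _ a≡b _ = a≡b
  ... | tri> _ _ b<a = ⊥-elim (strictlyAscending⇒distinct x ascending b<a (sym xa≡xb))

  -- Colour the m-th point of the chain by m mod k; colour i occurs above x a at i + a * k.
  strictlyAscending⇒resolvable : (x : ℕ → W) → IsStrictlyAscending R x →
                                 (k : ℕ) .{{_ : NonZero k}} → Resolvable R k (Range x)
  strictlyAscending⇒resolvable x ascending k =
    colouring⇒resolvable x (strictlyAscending-injective x ascending) (_mod k) cofinal
    where
    cofinal : ∀ a i → ∃[ b ] (b mod k ≡ i × R (x a) (x b))
    cofinal a i = toℕ i + a * k
                , toℕ-injective (trans (toℕ-fromℕ< _)
                    (trans ([m+kn]%n≡m%n (toℕ i) a k) (m<n⇒m%n≡m (toℕ<n i))))
                , ascending⇒monotone x (proj₁ ∘ ascending) (≤-trans (m≤m*n a k) (m≤n+m (a * k) (toℕ i)))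

  path⇒first-reaches : ∀ m (x : Fin (suc m) → W) → (∀ i → R (x (inject₁ i)) (x (fsuc i))) →
                       ∀ j → R (x fzero) (x j)
  path⇒first-reaches m       x step fzero    = reflexive
  path⇒first-reaches (suc m) x step (fsuc j) =
    transitive (path⇒first-reaches m (x ∘ inject₁) (step ∘ inject₁) j) (step j)

  path⇒reaches-last : ∀ m (x : Fin (suc m) → W) → (∀ i → R (x (inject₁ i)) (x (fsuc i))) →
                      ∀ i → R (x i) (x (fromℕ m))
  path⇒reaches-last m       x step fzero    = path⇒first-reaches m x step (fromℕ m)
  path⇒reaches-last (suc m) x step (fsuc i) = path⇒reaches-last m (x ∘ fsuc) (step ∘ fsuc) i

  cycle⇒clique : ∀ {m} (c : Cycle R m) → IsClique R (proj₁ c)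
  cycle⇒clique {m} (x , _ , step , closing) i j =
    transitive (path⇒reaches-last m x step i) (transitive closing (path⇒first-reaches m x step j))

  clique⇒cycle : ∀ {m} (x : Fin (suc m) → W) → Injective _≡_ _≡_ x → IsClique R x → Cycle R m
  clique⇒cycle {m} x x-injective clique =
    x , x-injective , (λ i → clique (inject₁ i) (fsuc i)) , clique (fromℕ m) fzero

  -- If x had no strict successor in S, then choosing one point above x from each of
  -- the n + 1 disjoint dense sets would give n + 1 distinct points, all equivalent to x.
  resolvable⇒strictSuccessor : DoubleNegationElimination 0ℓ → ∀ n → CircumferenceAtMost R n →
                               ∀ {S} → Resolvable R (suc n) S → ∀ {x} → S x → StrictSuccessorIn R S x
  resolvable⇒strictSuccessor dne n circumference {S} (D , dense , disjoint) {x} x∈S =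
    dne λ noSuccessor →
      let below : ∀ i → R (y i) x
          below i = dne λ y≰x → noSuccessor (y i , proj₁ (dense i) (y i) (y∈D i) , x≤y i , y≰x)
          clique : IsClique R y
          clique i j = transitive (below i) (x≤y j)
      in <-irrefl refl (circumference n (clique⇒cycle y y-injective clique))
    where
    above : ∀ i → ∃[ y ] (D i y × R x y)
    above i = proj₂ (dense i) (R x) transitive (x , x∈S , reflexive)

    y : Fin (suc n) → W
    y i = proj₁ (above i)

    y∈D : ∀ i → D i (y i)
    y∈D i = proj₁ (proj₂ (above i))

    x≤y : ∀ i → R x (y i)
    x≤y i = proj₂ (proj₂ (above i))

    y-injective : Injective _≡_ _≡_ y
    y-injective {i} {j} yi≡yj with i ≟ j
    ... | yes i≡j = i≡j
    ... | no  i≢j = ⊥-elim (disjoint i j i≢j (y i) (y∈D i) (subst (D j) (sym yi≡yj) (y∈D j)))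

  hereditarilyIrresolvable⇒circumferenceAtMost : ∀ n → HereditarilyIrresolvable R (suc n) →
                                                 CircumferenceAtMost R n
  hereditarilyIrresolvable⇒circumferenceAtMost n irresolvable m c with suc m ≤? n
  ... | yes short = short
  ... | no  long  = ⊥-elim (irresolvable (Range x) (x fzero , fzero , refl)
                      (clique⇒resolvable x x-injective (λ i j → cycle⇒clique c (embed i) (embed j))))
    where
    1+n≤1+m : suc n ≤ suc m
    1+n≤1+m = ≰⇒> long

    embed : Fin (suc n) → Fin (suc m)
    embed i = inject≤ i 1+n≤1+m

    x : Fin (suc n) → W
    x = proj₁ c ∘ embed

    x-injective : Injective _≡_ _≡_ x
    x-injective = inject≤-injective 1+n≤1+m 1+n≤1+m _ _ ∘ proj₁ (proj₂ c)

  hereditarilyIrresolvable⇒noChain : ∀ n → HereditarilyIrresolvable R (suc n) →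
                                     ¬ StrictlyAscendingChain R
  hereditarilyIrresolvable⇒noChain n irresolvable (x , ascending) =
    irresolvable (Range x) (x 0 , 0 , refl) (strictlyAscending⇒resolvable x ascending (suc n))

  finite⇒noChain : ∀ {k} → W ↔ Fin k → ¬ StrictlyAscendingChain R
  finite⇒noChain W↔Fin (x , ascending) = ℕ→Fin-notInjective (Injection.to W↣Fin ∘ x)
    (λ eq → strictlyAscending-injective x ascending (Injection.injective W↣Fin eq))
    where
    W↣Fin : Injection _ _
    W↣Fin = ↔⇒↣ W↔Fin

  circumferenceAtMost⇒hereditarilyIrresolvable : ExcludedMiddle 0ℓ → ∀ n → CircumferenceAtMost R n →
                                                 ¬ StrictlyAscendingChain R →
                                                 HereditarilyIrresolvable R (suc n)
  circumferenceAtMost⇒hereditarilyIrresolvable em n circumference noChain S nonEmpty resolvable =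
    noChain (strictSuccessors⇒chain (resolvable⇒strictSuccessor (em⇒dne em) n circumference resolvable) nonEmpty)

theorem8p2 : ExcludedMiddle 0ℓ →
    (W : Set) (R : W → W → Set) → Reflexive R → Transitive R →
    (n : ℕ) → 1 ≤ n →
    (HereditarilyIrresolvable R (suc n) ⇔ (CircumferenceAtMost R n × ¬ StrictlyAscendingChain R))
    × ((k : ℕ) → W ↔ Fin k → (HereditarilyIrresolvable R (suc n) ⇔ CircumferenceAtMost R n))
theorem8p2 em W R reflexive transitive n _ = general , finite
  where
  irresolvable⇒circumference : HereditarilyIrresolvable R (suc n) → CircumferenceAtMost R n
  irresolvable⇒circumference = hereditarilyIrresolvable⇒circumferenceAtMost reflexive transitive n
  circumference⇒irresolvable : CircumferenceAtMost R n → ¬ StrictlyAscendingChain R →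
                               HereditarilyIrresolvable R (suc n)
  circumference⇒irresolvable = circumferenceAtMost⇒hereditarilyIrresolvable reflexive transitive em n

  general : HereditarilyIrresolvable R (suc n) ⇔ (CircumferenceAtMost R n × ¬ StrictlyAscendingChain R)
  general = mk⇔ (λ irresolvable → irresolvable⇒circumference irresolvable
                                 , hereditarilyIrresolvable⇒noChain reflexive transitive n irresolvable)
                 (λ (circumference , noChain) → circumference⇒irresolvable circumference noChain)

  finite : (k : ℕ) → W ↔ Fin k → HereditarilyIrresolvable R (suc n) ⇔ CircumferenceAtMost R n
  finite k W↔Fin = mk⇔ irresolvable⇒circumference
    (λ circumference → circumference⇒irresolvable circumference (finite⇒noChain {R = R} reflexive transitive W↔Fin))
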